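{- For any finite simple graph $H$ on $n$ vertices with $e(H)$ edges we have $$i(H)\geq 2^n\left(\frac{3}{4}\right)^{e(H)}.$$ Furthermore, if $H$ is connected then $$i(H)> \frac{3}{4}\left(\frac{1+\sqrt{5}}{3}\right)^n\cdot 2^n\left(\frac{3}{4}\right)^{e(H)}.$$
   Context: $i(H)$ denotes the number of independent sets of $H$ (including the empty set), i.e. subsets of $V(H)$ containing no edge of $H$. -}

module Defs where

open import Data.Nat using (ℕ; zero; suc; _+_; _*_; _∸_; _^_; _<_; _<ᵇ_)
open import Data.Bool using (Bool; true; false; not; _∧_; _∨_)
open import Data.Fin using (Fin; toℕ)
open import Data.Fin.Subset using (Subset)
open import Data.Vec using (Vec; []; _∷_; lookup)
open import Data.List using (List; []; _∷_; length; filterᵇ; map; concatMap; allFin; _++_)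
open import Data.Bool.ListAction using (any)
open import Data.Product using (_×_; _,_)
open import Relation.Binary.PropositionalEquality using (_≡_)

record Graph (n : ℕ) : Set where
  field
    adj    : Fin n → Fin n → Bool
    sym    : ∀ u v → adj u v ≡ adj v u
    irrefl : ∀ u → adj u u ≡ false
open Graph public

pairs : (n : ℕ) → List (Fin n × Fin n)
pairs n = concatMap (λ u → map (λ v → (u , v)) (filterᵇ (λ v → toℕ u <ᵇ toℕ v) (allFin n))) (allFin n)

edges : ∀ {n} → Graph n → ℕ
edges {n} H = length (filterᵇ (λ p → adj H (Data.Product.proj₁ p) (Data.Product.proj₂ p)) (pairs n))

allSubsets : (n : ℕ) → List (Subset n)
allSubsets zero    = [] ∷ []
allSubsets (suc n) = map (true ∷_) (allSubsets n) ++ map (false ∷_) (allSubsets n)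

isIndependent : ∀ {n} → Graph n → Subset n → Bool
isIndependent {n} H S =
  not (any (λ p → lookup S (Data.Product.proj₁ p) ∧ lookup S (Data.Product.proj₂ p)
                   ∧ adj H (Data.Product.proj₁ p) (Data.Product.proj₂ p)) (pairs n))

-- i(H): the number of independent sets (including the empty set).
indepCount : ∀ {n} → Graph n → ℕ
indepCount H = length (filterᵇ (isIndependent H) (allSubsets _))

data Reach {n : ℕ} (H : Graph n) : Fin n → Fin n → Set where
  here : ∀ {u} → Reach H u u
  step : ∀ {u v w} → adj H u v ≡ true → Reach H v w → Reach H u w

Connected : ∀ {n} → Graph n → Set
Connected H = ∀ u v → Reach H u v

-- (1 + √5)^k = sqA k + sqB k · √5 with sqA k, sqB k ∈ ℕ.
sqA sqB : ℕ → ℕ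
sqA zero    = 1
sqA (suc k) = sqA k + 5 * sqB k
sqB zero    = 0
sqB (suc k) = sqA k + sqB k

-- y + z·√5 < x  (for naturals x, y, z), stated exactly over ℕ:
-- equivalent to  y < x  and  5 z² < (x − y)².
LtSqrt5 : (y z x : ℕ) → Set
LtSqrt5 y z x = (y < x) × (5 * (z * z) < (x ∸ y) * (x ∸ y))

module Submission where

-- Within a down-closed family of subsets, the sets containing both ends u, v of a new edge are
-- mapped injectively (delete u, delete v, delete both) into the three classes of sets avoiding
-- the edge, so imposing the edge keeps at least 3/4 of the family. Starting from all 2ⁿ subsets
-- and imposing the e edges one at a time gives i(H) ≥ 2ⁿ (3/4)ᵉ. For connected H, start instead
-- from the independent sets of a spanning tree T: attaching a leaf v to p gives the Fibonacci
-- recursion i(T) = i(T - v) + i(T - v - p), so i(T) ≥ F(n+2); imposing the remaining e - n + 1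
-- edges gives i(H) ≥ F(n+2) (3/4)^(e-n+1). Finally (1 + √5)ⁿ = a + b√5 < a + 3b = 2ⁿ F(n+2).

open import Algebra using (CommutativeMonoid)
import Algebra.Properties.CommutativeSemigroup as CommutativeSemigroupProperties
open import Data.Bool using (Bool; true; false; not; _∧_; _∨_; if_then_else_; T)
open import Data.Bool.ListAction using (all; any)
open import Data.Bool.Properties as Bool using (∧-assoc; ∧-comm; ∧-identityʳ; T-∧)
open import Data.Bool.Solver using (module ∨-∧-Solver)
open import Data.Empty using (⊥-elim)
open import Data.Fin using (Fin; toℕ; zero; suc) renaming (_≟_ to _≟ᶠ_)
open import Data.Fin.Properties using (¬∀⟶∃¬; toℕ-injective)
open import Data.Fin.Subset using (Subset; _⊆_; _∈_; _∉_; ∣_∣; ⊤; ⁅_⁆)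
open import Data.Fin.Subset.Properties using (_∈?_; x∈⁅x⁆; ∣⁅x⁆∣≡1; ∣⊤∣≡n; p⊆q⇒∣p∣≤∣q∣)
open import Data.List using (List; []; _∷_; _++_; length; filterᵇ; map; allFin)
open import Data.List.Membership.Propositional using (lose) renaming (_∈_ to _∈ₗ_)
open import Data.List.Membership.Propositional.Properties
  using (∈-∃++; ∈-allFin; ∈-concatMap⁺; ∈-concatMap⁻; ∈-map⁺; ∈-map⁻; ∈-filter⁺; ∈-filter⁻)
open import Data.List.Properties using (filter-++; length-++)
open import Data.List.Relation.Binary.Permutation.Propositional as ↭ using (_↭_; ↭-refl; ↭-prep; ↭-trans)
open import Data.List.Relation.Binary.Permutation.Propositional.Properties
  using (shift; ∈-resp-↭; ↭-length; All-resp-↭)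
open import Data.List.Relation.Unary.All as All using (All; []; _∷_)
open import Data.List.Relation.Unary.All.Properties using (++⁻ʳ)
open import Data.List.Relation.Unary.Any using (here; there; satisfied)
open import Data.List.Relation.Unary.Unique.Propositional using (Unique; []; _∷_)
open import Data.Nat using (ℕ; zero; suc; _+_; _*_; _∸_; _^_; _≤_; _<_; z≤n; s≤s; _<ᵇ_; _≤′_; ≤′-reflexive; ≤′-step)
open import Data.Nat.Properties
open import Data.Nat.Tactic.RingSolver using (solve-∀)
open import Data.Product using (_×_; _,_; proj₁; proj₂; ∃-syntax)
open import Data.Vec using ([]; _∷_; lookup; _[_]≔_)
open import Data.Vec.Properties using ([]≔-updates; []≔-minimal; []≔-lookup; lookup∘update′; []=⇒lookup; lookup⇒[]=)
open import Function using (_∘_; id)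
open import Function.Bundles using (Equivalence)
open import Relation.Binary.PropositionalEquality
open import Relation.Nullary using (yes; no; ¬_)
open import Relation.Nullary.Decidable using (T?)

open import Defs hiding (sym)

private
  variable
    n : ℕ

module ∧-Props = CommutativeSemigroupProperties (CommutativeMonoid.commutativeSemigroup Bool.∧-commutativeMonoid)
module +-Props = CommutativeSemigroupProperties +-commutativeSemigroup
module *-Props = CommutativeSemigroupProperties *-commutativeSemigroup

∧-monoʳ-T : ∀ a {b c} → (T b → T c) → T (a ∧ b) → T (a ∧ c)
∧-monoʳ-T true  b⇒c = b⇒c
∧-monoʳ-T false b⇒c = λ ()

length-filterᵇ-map : ∀ {A B : Set} (p : B → Bool) (f : A → B) xs →
                     length (filterᵇ p (map f xs)) ≡ length (filterᵇ (p ∘ f) xs)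
length-filterᵇ-map p f [] = refl
length-filterᵇ-map p f (x ∷ xs) with p (f x)
... | true  = cong suc (length-filterᵇ-map p f xs)
... | false = length-filterᵇ-map p f xs

∈-filterᵇ⁻ : ∀ {A : Set} (p : A → Bool) {x} xs → x ∈ₗ filterᵇ p xs → x ∈ₗ xs × T (p x)
∈-filterᵇ⁻ p xs = ∈-filter⁻ {P = T ∘ p} (T? ∘ p) {xs = xs}

∈-filterᵇ⁺ : ∀ {A : Set} (p : A → Bool) {x xs} → x ∈ₗ xs → T (p x) → x ∈ₗ filterᵇ p xs
∈-filterᵇ⁺ p = ∈-filter⁺ {P = T ∘ p} (T? ∘ p)

all-++ : ∀ {A : Set} (p : A → Bool) xs ys → all p (xs ++ ys) ≡ all p xs ∧ all p ys
all-++ p []       ys = refl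
all-++ p (x ∷ xs) ys = trans (cong (p x ∧_) (all-++ p xs ys)) (sym (∧-assoc (p x) _ _))

all-↭ : ∀ {A : Set} (p : A → Bool) {xs ys} → xs ↭ ys → all p xs ≡ all p ys
all-↭ p ↭.refl                 = refl
all-↭ p (↭.prep x xs↭ys)       = cong (p x ∧_) (all-↭ p xs↭ys)
all-↭ p (↭.swap x y xs↭ys)     = trans (cong (λ b → p x ∧ (p y ∧ b)) (all-↭ p xs↭ys)) (∧-Props.x∙yz≈y∙xz (p x) (p y) _)
all-↭ p (↭.trans xs↭ys ys↭zs) = trans (all-↭ p xs↭ys) (all-↭ p ys↭zs)

∈-++-remove : ∀ {A : Set} {x y : A} xs ys → y ∈ₗ xs ++ x ∷ ys → y ≢ x → y ∈ₗ xs ++ ys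
∈-++-remove {x = x} xs ys y∈ y≢x with ∈-resp-↭ (shift x xs ys) y∈
... | here y≡x   = ⊥-elim (y≢x y≡x)
... | there y∈′ = y∈′

↭-++-complement : ∀ {A : Set} {xs ys : List A} → Unique xs → (∀ {x} → x ∈ₗ xs → x ∈ₗ ys) → ∃[ zs ] ys ↭ xs ++ zs
↭-++-complement {xs = []} {ys} _ _ = ys , ↭-refl
↭-++-complement {xs = x ∷ xs} (x∉xs ∷ xs-unique) xs⊆ys with ∈-∃++ (xs⊆ys (here refl))
... | ys₁ , ys₂ , refl =
  let (zs , ys₁++ys₂↭xs++zs) = ↭-++-complement xs-unique
        (λ y∈xs → ∈-++-remove ys₁ ys₂ (xs⊆ys (there y∈xs)) (All.lookup x∉xs y∈xs ∘ sym))
  in zs , ↭-trans (shift x ys₁ ys₂) (↭-prep x ys₁++ys₂↭xs++zs)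

⊆-insert : (S : Subset n) (u : Fin n) → S ⊆ S [ u ]≔ true
⊆-insert S u {x} x∈S with x ≟ᶠ u
... | yes refl = []≔-updates S u
... | no  x≢u  = []≔-minimal S x u x≢u x∈S

∉⇒lookup≡false : (L : Subset n) (v : Fin n) → v ∉ L → lookup L v ≡ false
∉⇒lookup≡false L v v∉L with lookup L v in v↦b
... | true  = ⊥-elim (v∉L (lookup⇒[]= v L v↦b))
... | false = refl

[]≔-lookup′ : (A : Subset n) (v : Fin n) {b : Bool} → lookup A v ≡ b → A [ v ]≔ b ≡ A
[]≔-lookup′ A v v↦b = trans (cong (A [ v ]≔_) (sym v↦b)) ([]≔-lookup A v)

∣insert∣≡1+∣remove∣ : (A : Subset n) (v : Fin n) → ∣ A [ v ]≔ true ∣ ≡ suc ∣ A [ v ]≔ false ∣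
∣insert∣≡1+∣remove∣ (a ∷ A)     zero    = refl
∣insert∣≡1+∣remove∣ (true ∷ A)  (suc v) = cong suc (∣insert∣≡1+∣remove∣ A v)
∣insert∣≡1+∣remove∣ (false ∷ A) (suc v) = ∣insert∣≡1+∣remove∣ A v

∣A∣≡1+∣remove∣ : (A : Subset n) (v : Fin n) → lookup A v ≡ true → ∣ A ∣ ≡ suc ∣ A [ v ]≔ false ∣
∣A∣≡1+∣remove∣ A v v∈A = trans (cong ∣_∣ (sym ([]≔-lookup′ A v v∈A))) (∣insert∣≡1+∣remove∣ A v)

∣A∣≤1+∣remove∣ : (A : Subset n) (v : Fin n) → ∣ A ∣ ≤ suc ∣ A [ v ]≔ false ∣
∣A∣≤1+∣remove∣ A v with lookup A v in v↦b
... | true  = ≤-reflexive (∣A∣≡1+∣remove∣ A v v↦b)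
... | false = ≤-trans (n≤1+n ∣ A ∣) (≤-reflexive (cong (suc ∘ ∣_∣) (sym ([]≔-lookup′ A v v↦b))))

∣p∣<n⇒∃∉ : (L : Subset n) → ∣ L ∣ < n → ∃[ w ] w ∉ L
∣p∣<n⇒∃∉ {n} L ∣L∣<n = ¬∀⟶∃¬ n (_∈ L) (_∈? L) λ all∈L →
  <⇒≱ ∣L∣<n (≤-trans (≤-reflexive (sym (∣⊤∣≡n n))) (p⊆q⇒∣p∣≤∣q∣ {p = ⊤} (λ {x} _ → all∈L x)))

Family : ℕ → Set
Family n = Subset n → Bool

infixr 6 _∩_
_∩_ : Family n → Family n → Family n
(P ∩ Q) S = P S ∧ Q S

count : Family n → ℕ
count {zero}  P = if P [] then 1 else 0
count {suc n} P = count (P ∘ (true ∷_)) + count (P ∘ (false ∷_))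

count-cong : {P Q : Family n} → P ≗ Q → count P ≡ count Q
count-cong {zero}  P≗Q = cong (λ b → if b then 1 else 0) (P≗Q [])
count-cong {suc n} P≗Q = cong₂ _+_ (count-cong (P≗Q ∘ (true ∷_))) (count-cong (P≗Q ∘ (false ∷_)))

count-mono : {P Q : Family n} → (∀ S → T (P S) → T (Q S)) → count P ≤ count Q
count-mono {zero} {P} {Q} P⇒Q with P [] | Q [] | P⇒Q []
... | false | _     | _  = z≤n
... | true  | true  | _  = ≤-refl
... | true  | false | f  = ⊥-elim (f _)
count-mono {suc n} P⇒Q = +-mono-≤ (count-mono (P⇒Q ∘ (true ∷_))) (count-mono (P⇒Q ∘ (false ∷_)))

count-split : (Q P : Family n) → count P ≡ count (Q ∩ P) + count ((not ∘ Q) ∩ P)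
count-split {zero} Q P with Q [] | P []
... | true  | true  = refl
... | true  | false = refl
... | false | true  = refl
... | false | false = refl
count-split {suc n} Q P =
  trans (cong₂ _+_ (count-split Q₁ P₁) (count-split Q₀ P₀))
        (+-Props.interchange (count (Q₁ ∩ P₁)) (count ((not ∘ Q₁) ∩ P₁)) (count (Q₀ ∩ P₀)) (count ((not ∘ Q₀) ∩ P₀)))
  where
  Q₁ Q₀ P₁ P₀ : Family n
  Q₁ = Q ∘ (true ∷_)
  Q₀ = Q ∘ (false ∷_)
  P₁ = P ∘ (true ∷_)
  P₀ = P ∘ (false ∷_)

count-true : count {n} (λ _ → true) ≡ 2 ^ n
count-true {zero}  = refl
count-true {suc n} = cong₂ _+_ (count-true {n}) (trans (count-true {n}) (sym (+-identityʳ _)))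

count-false : count {n} (λ _ → false) ≡ 0
count-false {zero}  = refl
count-false {suc n} = cong₂ _+_ (count-false {n}) (count-false {n})

count-allSubsets : (P : Family n) → length (filterᵇ P (allSubsets n)) ≡ count P
count-allSubsets {zero} P with P []
... | true  = refl
... | false = refl
count-allSubsets {suc n} P = begin
  length (filterᵇ P (map (true ∷_) (allSubsets n) ++ map (false ∷_) (allSubsets n)))
    ≡⟨ cong length (filter-++ (T? ∘ P) (map (true ∷_) (allSubsets n)) _) ⟩
  length (filterᵇ P (map (true ∷_) (allSubsets n)) ++ filterᵇ P (map (false ∷_) (allSubsets n)))
    ≡⟨ length-++ (filterᵇ P (map (true ∷_) (allSubsets n))) ⟩
  length (filterᵇ P (map (true ∷_) (allSubsets n))) + length (filterᵇ P (map (false ∷_) (allSubsets n)))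
    ≡⟨ cong₂ _+_ (length-filterᵇ-map P (true ∷_) (allSubsets n)) (length-filterᵇ-map P (false ∷_) (allSubsets n)) ⟩
  length (filterᵇ (P ∘ (true ∷_)) (allSubsets n)) + length (filterᵇ (P ∘ (false ∷_)) (allSubsets n))
    ≡⟨ cong₂ _+_ (count-allSubsets (P ∘ (true ∷_))) (count-allSubsets (P ∘ (false ∷_))) ⟩
  count P ∎
  where open ≡-Reasoning

count-∋-insert : (u : Fin n) (Q : Family n) →
                 count (λ S → lookup S u ∧ Q S) ≡ count (λ S → not (lookup S u) ∧ Q (S [ u ]≔ true))
count-∋-insert {suc n} zero    Q = +-comm (count (Q ∘ (true ∷_))) (count {n} (λ _ → false))
count-∋-insert {suc n} (suc u) Q = cong₂ _+_ (count-∋-insert u (Q ∘ (true ∷_))) (count-∋-insert u (Q ∘ (false ∷_)))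

DeletionClosed : Fin n → Family n → Set
DeletionClosed u Q = ∀ S → T (Q (S [ u ]≔ true)) → T (Q S)

count-∋≤count-∌ : (u : Fin n) (Q : Family n) → DeletionClosed u Q →
                  count (λ S → lookup S u ∧ Q S) ≤ count (λ S → not (lookup S u) ∧ Q S)
count-∋≤count-∌ u Q closed = begin
  count (λ S → lookup S u ∧ Q S)                        ≡⟨ count-∋-insert u Q ⟩
  count (λ S → not (lookup S u) ∧ Q (S [ u ]≔ true))    ≤⟨ count-mono (λ S → ∧-monoʳ-T (not (lookup S u)) (closed S)) ⟩
  count (λ S → not (lookup S u) ∧ Q S)                  ∎
  where open ≤-Reasoning

-- Adding an edge to a down-closed family

DownClosed : Family n → Set
DownClosed P = ∀ {S S′} → S′ ⊆ S → T (P S) → T (P S′)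

downClosed⇒deletionClosed : {P : Family n} → DownClosed P → (u : Fin n) → DeletionClosed u P
downClosed⇒deletionClosed down u S = down (⊆-insert S u)

deletionClosed-literal : {u w : Fin n} {Q : Family n} → w ≢ u → (f : Bool → Bool) →
                         DeletionClosed u Q → DeletionClosed u (λ S → f (lookup S w) ∧ Q S)
deletionClosed-literal {u = u} {w} {Q} w≢u f closed S =
  ∧-monoʳ-T (f (lookup S w)) (closed S) ∘ subst (λ b → T (f b ∧ Q (S [ u ]≔ true))) (lookup∘update′ w≢u S true)

avoids : Fin n × Fin n → Family n
avoids (u , v) S = not (lookup S u ∧ lookup S v)

3*count≤4*count-avoids : {P : Family n} {u v : Fin n} → DownClosed P → u ≢ v →
                         3 * count P ≤ 4 * count (avoids (u , v) ∩ P)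
3*count≤4*count-avoids {n} {P} {u} {v} down u≢v = begin
  3 * count P        ≡⟨ cong (3 *_) (count-split (λ S → x S ∧ y S) P) ⟩
  3 * (count (λ S → (x S ∧ y S) ∧ P S) + A)
                     ≡⟨ cong (λ b → 3 * (b + A)) (count-cong (λ S → ∧-assoc (x S) (y S) (P S))) ⟩
  3 * (both + A)     ≡⟨ *-distribˡ-+ 3 both A ⟩
  3 * both + 3 * A   ≤⟨ +-monoˡ-≤ (3 * A) 3*both≤A ⟩
  A + 3 * A          ∎
  where
  open ≤-Reasoning
  x y x̄ ȳ : Family n
  x S = lookup S u
  y S = lookup S v
  x̄ = not ∘ x
  ȳ = not ∘ y
  A both u∉v∈ u∉v∉ u∈v∉ : ℕ
  A     = count (avoids (u , v) ∩ P)
  both  = count (x ∩ y ∩ P)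
  u∈v∉ = count (x ∩ ȳ ∩ P)
  u∉v∈ = count (y ∩ x̄ ∩ P)
  u∉v∉ = count (ȳ ∩ x̄ ∩ P)
  u∈-avoids : ∀ a b p → a ∧ (not (a ∧ b) ∧ p) ≡ a ∧ (not b ∧ p)
  u∈-avoids true  b p = refl
  u∈-avoids false b p = refl
  u∉-avoids : ∀ a b p → not a ∧ (not (a ∧ b) ∧ p) ≡ not a ∧ p
  u∉-avoids true  b p = refl
  u∉-avoids false b p = refl
  A-split : A ≡ u∈v∉ + (u∉v∈ + u∉v∉)
  A-split = begin-equality
    A                                                         ≡⟨ count-split x (avoids (u , v) ∩ P) ⟩
    count (x ∩ avoids (u , v) ∩ P) + count (x̄ ∩ avoids (u , v) ∩ P)
        ≡⟨ cong₂ _+_ (count-cong (λ S → u∈-avoids (x S) (y S) (P S))) (count-cong (λ S → u∉-avoids (x S) (y S) (P S))) ⟩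
    u∈v∉ + count (x̄ ∩ P)                                     ≡⟨ cong (u∈v∉ +_) (count-split y (x̄ ∩ P)) ⟩
    u∈v∉ + (u∉v∈ + u∉v∉)                                     ∎
  swap-literals : ∀ (a b : Family n) → count (a ∩ b ∩ P) ≡ count (b ∩ a ∩ P)
  swap-literals a b = count-cong (λ S → ∧-Props.x∙yz≈y∙xz (a S) (b S) (P S))
  v≢u : v ≢ u
  v≢u = u≢v ∘ sym
  both≤u∈v∉ : both ≤ u∈v∉
  both≤u∈v∉ = begin
    both                 ≡⟨ swap-literals x y ⟩
    count (y ∩ x ∩ P)    ≤⟨ count-∋≤count-∌ v (x ∩ P) (deletionClosed-literal u≢v id (downClosed⇒deletionClosed down v)) ⟩
    count (ȳ ∩ x ∩ P)    ≡⟨ swap-literals ȳ x ⟩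
    u∈v∉                 ∎
  both≤u∉v∈ : both ≤ u∉v∈
  both≤u∉v∈ = begin
    both                 ≤⟨ count-∋≤count-∌ u (y ∩ P) (deletionClosed-literal v≢u id (downClosed⇒deletionClosed down u)) ⟩
    count (x̄ ∩ y ∩ P)    ≡⟨ swap-literals x̄ y ⟩
    u∉v∈                 ∎
  u∉v∈≤u∉v∉ : u∉v∈ ≤ u∉v∉
  u∉v∈≤u∉v∉ = count-∋≤count-∌ v (x̄ ∩ P) (deletionClosed-literal u≢v not (downClosed⇒deletionClosed down v))
  3*both≤A : 3 * both ≤ A
  3*both≤A = begin
    3 * both                  ≡⟨ cong (λ b → both + (both + b)) (+-identityʳ both) ⟩
    both + (both + both)      ≤⟨ +-mono-≤ both≤u∈v∉ (+-mono-≤ both≤u∉v∈ (≤-trans both≤u∉v∈ u∉v∈≤u∉v∉)) ⟩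
    u∈v∉ + (u∉v∈ + u∉v∉)     ≡⟨ A-split ⟨
    A                         ∎

Edge : ℕ → Set
Edge n = Fin n × Fin n

Loopless : List (Edge n) → Set
Loopless = All (λ e → proj₁ e ≢ proj₂ e)

independent : List (Edge n) → Family n
independent E S = all (λ e → avoids e S) E

∩-downClosed : {P Q : Family n} → DownClosed P → DownClosed Q → DownClosed (P ∩ Q)
∩-downClosed downP downQ S′⊆S PQ =
  let (p , q) = Equivalence.to T-∧ PQ in Equivalence.from T-∧ (downP S′⊆S p , downQ S′⊆S q)

avoids-downClosed : (e : Edge n) → DownClosed (avoids e)
avoids-downClosed (a , b) {S} {S′} S′⊆S avoided with lookup S′ a in a∈S′ | lookup S′ b in b∈S′
... | false | _     = _
... | true  | false = _
... | true  | true
  rewrite []=⇒lookup (S′⊆S (lookup⇒[]= a S′ a∈S′)) | []=⇒lookup (S′⊆S (lookup⇒[]= b S′ b∈S′)) = avoided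

independent-downClosed : (E : List (Edge n)) → DownClosed (independent E)
independent-downClosed []      _ _ = _
independent-downClosed (e ∷ E) = ∩-downClosed (avoids-downClosed e) (independent-downClosed E)

3^∣R∣*count≤4^∣R∣*count-independent : {P : Family n} → DownClosed P → (R : List (Edge n)) → Loopless R →
  3 ^ length R * count P ≤ 4 ^ length R * count (P ∩ independent R)
3^∣R∣*count≤4^∣R∣*count-independent {P = P} down []      []            =
  ≤-reflexive (cong (1 *_) (count-cong (λ S → sym (∧-identityʳ (P S)))))
3^∣R∣*count≤4^∣R∣*count-independent {P = P} down (e ∷ R) (e-loopless ∷ R-loopless) = begin
  3 * 3 ^ k * count P                    ≡⟨ *-assoc 3 (3 ^ k) (count P) ⟩
  3 * (3 ^ k * count P)                  ≤⟨ *-monoʳ-≤ 3 (3^∣R∣*count≤4^∣R∣*count-independent down R R-loopless) ⟩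
  3 * (4 ^ k * count (P ∩ independent R)) ≡⟨ *-Props.x∙yz≈y∙xz 3 (4 ^ k) _ ⟩
  4 ^ k * (3 * count (P ∩ independent R)) ≤⟨ *-monoʳ-≤ (4 ^ k) (3*count≤4*count-avoids (∩-downClosed down (independent-downClosed R)) e-loopless) ⟩
  4 ^ k * (4 * count (avoids e ∩ P ∩ independent R))
      ≡⟨ cong (4 ^ k *_) (cong (4 *_) (count-cong (λ S → ∧-Props.x∙yz≈y∙xz (avoids e S) (P S) (independent R S)))) ⟩
  4 ^ k * (4 * count (P ∩ independent (e ∷ R))) ≡⟨ *-Props.x∙yz≈y∙xz (4 ^ k) 4 _ ⟩
  4 * (4 ^ k * count (P ∩ independent (e ∷ R))) ≡⟨ *-assoc 4 (4 ^ k) _ ⟨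
  4 * 4 ^ k * count (P ∩ independent (e ∷ R)) ∎
  where
  open ≤-Reasoning
  k : ℕ
  k = length R

-- Independent sets of forests

-- The orientation in which pairs lists the edge {p, v}.
canonical : Fin n → Fin n → Edge n
canonical p v = if toℕ p <ᵇ toℕ v then (p , v) else (v , p)

canonical-endpoints : (P : Fin n → Set) {p v : Fin n} → P p → P v → P (proj₁ (canonical p v)) × P (proj₂ (canonical p v))
canonical-endpoints P {p} {v} Pp Pv with toℕ p <ᵇ toℕ v
... | true  = Pp , Pv
... | false = Pv , Pp

avoids-canonical : (p v : Fin n) (S : Subset n) → avoids (canonical p v) S ≡ not (lookup S v ∧ lookup S p)
avoids-canonical p v S with toℕ p <ᵇ toℕ v
... | true  = cong not (∧-comm (lookup S p) (lookup S v))
... | false = refl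

_∉ᵉ_ : Fin n → Edge n → Set
v ∉ᵉ (a , b) = a ≢ v × b ≢ v

canonical-∋ : (p v : Fin n) → ¬ v ∉ᵉ canonical p v
canonical-∋ p v with toℕ p <ᵇ toℕ v
... | true  = λ v∉ → proj₂ v∉ refl
... | false = λ v∉ → proj₁ v∉ refl

independent-insert-fresh : {E : List (Edge n)} {v : Fin n} → All (v ∉ᵉ_) E →
                           ∀ S b → independent E (S [ v ]≔ b) ≡ independent E S
independent-insert-fresh []                   S b = refl
independent-insert-fresh ((a≢v , b≢v) ∷ fresh) S b =
  cong₂ (λ x y → not x ∧ y) (cong₂ _∧_ (lookup∘update′ a≢v S b) (lookup∘update′ b≢v S b)) (independent-insert-fresh fresh S b)

data Forest {n : ℕ} : List (Edge n) → Set where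
  []   : Forest []
  grow : ∀ {E} {p v : Fin n} → p ≢ v → All (v ∉ᵉ_) E → Forest E → Forest (canonical p v ∷ E)

forest-unique : {E : List (Edge n)} → Forest E → Unique E
forest-unique []                              = []
forest-unique (grow {p = p} {v} _ fresh forest) =
  All.map (λ v∉e e≡ → canonical-∋ p v (subst (v ∉ᵉ_) (sym e≡) v∉e)) fresh ∷ forest-unique forest

infix 4 _⊆ᵇ_
_⊆ᵇ_ : Subset n → Subset n → Bool
[]          ⊆ᵇ []      = true
(true ∷ S)  ⊆ᵇ (a ∷ A) = a ∧ (S ⊆ᵇ A)
(false ∷ S) ⊆ᵇ (_ ∷ A) = S ⊆ᵇ A

count-⊆ᵇ : (A : Subset n) → count (_⊆ᵇ A) ≡ 2 ^ ∣ A ∣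
count-⊆ᵇ []                  = refl
count-⊆ᵇ (true ∷ A)          = cong₂ _+_ (count-⊆ᵇ A) (trans (count-⊆ᵇ A) (sym (+-identityʳ _)))
count-⊆ᵇ {suc n} (false ∷ A) = cong₂ _+_ (count-false {n}) (count-⊆ᵇ A)

⊆ᵇ-⊤ : (S : Subset n) → (S ⊆ᵇ ⊤) ≡ true
⊆ᵇ-⊤ []          = refl
⊆ᵇ-⊤ (true ∷ S)  = ⊆ᵇ-⊤ S
⊆ᵇ-⊤ (false ∷ S) = ⊆ᵇ-⊤ S

⊆ᵇ-remove : (S A : Subset n) (v : Fin n) → (S ⊆ᵇ A [ v ]≔ false) ≡ not (lookup S v) ∧ (S ⊆ᵇ A)
⊆ᵇ-remove (true  ∷ S) (a ∷ A) zero    = refl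
⊆ᵇ-remove (false ∷ S) (a ∷ A) zero    = refl
⊆ᵇ-remove (true  ∷ S) (a ∷ A) (suc v) = trans (cong (a ∧_) (⊆ᵇ-remove S A v)) (∧-Props.x∙yz≈y∙xz a (not (lookup S v)) (S ⊆ᵇ A))
⊆ᵇ-remove (false ∷ S) (a ∷ A) (suc v) = ⊆ᵇ-remove S A v

⊆ᵇ-insert : (S A : Subset n) (v : Fin n) → lookup A v ≡ true → (S [ v ]≔ true ⊆ᵇ A) ≡ (S ⊆ᵇ A)
⊆ᵇ-insert (true  ∷ S) (.true ∷ A) zero    refl = refl
⊆ᵇ-insert (false ∷ S) (.true ∷ A) zero    refl = refl
⊆ᵇ-insert (true  ∷ S) (a ∷ A)     (suc v) v∈A  = cong (a ∧_) (⊆ᵇ-insert S A v v∈A)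
⊆ᵇ-insert (false ∷ S) (a ∷ A)     (suc v) v∈A  = ⊆ᵇ-insert S A v v∈A

⊆ᵇ-∉ : (S A : Subset n) (v : Fin n) → T (S ⊆ᵇ A) → lookup A v ≡ false → lookup S v ≡ false
⊆ᵇ-∉ (false ∷ S) (a ∷ A)      zero    _   _    = refl
⊆ᵇ-∉ (true  ∷ S) (.false ∷ A) zero    S⊆A refl = ⊥-elim S⊆A
⊆ᵇ-∉ (true  ∷ S) (a ∷ A)      (suc v) S⊆A v∉A  = ⊆ᵇ-∉ S A v (proj₂ (Equivalence.to T-∧ S⊆A)) v∉A
⊆ᵇ-∉ (false ∷ S) (a ∷ A)      (suc v) S⊆A v∉A  = ⊆ᵇ-∉ S A v S⊆A v∉A

fib : ℕ → ℕ
fib 0             = 0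
fib 1             = 1
fib (suc (suc n)) = fib (suc n) + fib n

fib≤fib-suc : ∀ n → fib n ≤ fib (suc n)
fib≤fib-suc zero    = z≤n
fib≤fib-suc (suc n) = m≤m+n (fib (suc n)) (fib n)

fib-mono : ∀ {m n} → m ≤ n → fib m ≤ fib n
fib-mono = mono′ ∘ ≤⇒≤′
  where
  mono′ : ∀ {m n} → m ≤′ n → fib m ≤ fib n
  mono′ (≤′-reflexive refl) = ≤-refl
  mono′ {n = suc n} (≤′-step m≤′n) = ≤-trans (mono′ m≤′n) (fib≤fib-suc n)

fib[2+n]≤2^n : ∀ n → fib (2 + n) ≤ 2 ^ n
fib[2+n]≤2^n zero    = ≤-refl
fib[2+n]≤2^n (suc n) = begin
  fib (2 + n) + fib (1 + n) ≤⟨ +-mono-≤ (fib[2+n]≤2^n n) (≤-trans (fib≤fib-suc (suc n)) (fib[2+n]≤2^n n)) ⟩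
  2 ^ n + 2 ^ n             ≡⟨ cong (2 ^ n +_) (+-identityʳ (2 ^ n)) ⟨
  2 ^ suc n                 ∎
  where open ≤-Reasoning

avoids-absent-leaf : (p v : Fin n) (S : Subset n) → lookup S v ≡ false → avoids (canonical p v) S ≡ true
avoids-absent-leaf p v S v∉S = trans (avoids-canonical p v S) (cong (λ b → not (b ∧ lookup S p)) v∉S)

count-omitting-leaf : (E : List (Edge n)) (p v : Fin n) (A : Subset n) →
  count (λ S → not (lookup S v) ∧ (S ⊆ᵇ A) ∧ independent (canonical p v ∷ E) S)
    ≡ count (λ S → (S ⊆ᵇ A [ v ]≔ false) ∧ independent E S)
count-omitting-leaf E p v A = count-cong λ S → begin
  not (lookup S v) ∧ (S ⊆ᵇ A) ∧ avoids (canonical p v) S ∧ independent E S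
    ≡⟨ cong (λ b → not (lookup S v) ∧ (S ⊆ᵇ A) ∧ b ∧ independent E S) (avoids-canonical p v S) ⟩
  not (lookup S v) ∧ (S ⊆ᵇ A) ∧ not (lookup S v ∧ lookup S p) ∧ independent E S
    ≡⟨ drop-edge (lookup S v) (S ⊆ᵇ A) (lookup S p) (independent E S) ⟩
  (not (lookup S v) ∧ (S ⊆ᵇ A)) ∧ independent E S
    ≡⟨ cong (_∧ independent E S) (⊆ᵇ-remove S A v) ⟨
  (S ⊆ᵇ A [ v ]≔ false) ∧ independent E S ∎
  where
  open ≡-Reasoning
  drop-edge : ∀ y w x i → not y ∧ w ∧ not (y ∧ x) ∧ i ≡ (not y ∧ w) ∧ i
  drop-edge true  w x i = refl
  drop-edge false w x i = refl

count-containing-leaf : {E : List (Edge n)} {p v : Fin n} → p ≢ v → All (v ∉ᵉ_) E → (A : Subset n) → lookup A v ≡ true →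
  count (λ S → lookup S v ∧ (S ⊆ᵇ A) ∧ independent (canonical p v ∷ E) S)
    ≡ count (λ S → (S ⊆ᵇ (A [ v ]≔ false) [ p ]≔ false) ∧ independent E S)
count-containing-leaf {n} {E} {p} {v} p≢v fresh A v∈A = begin
  count (λ S → lookup S v ∧ (S ⊆ᵇ A) ∧ independent (canonical p v ∷ E) S)
    ≡⟨ count-cong (λ S → cong (λ b → lookup S v ∧ (S ⊆ᵇ A) ∧ b ∧ independent E S) (avoids-canonical p v S)) ⟩
  count (λ S → lookup S v ∧ (S ⊆ᵇ A) ∧ not (lookup S v ∧ lookup S p) ∧ independent E S)
    ≡⟨ count-cong (λ S → force-neighbour-out (lookup S v) (S ⊆ᵇ A) (lookup S p) (independent E S)) ⟩
  count (λ S → lookup S v ∧ Q S)                         ≡⟨ count-∋-insert v Q ⟩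
  count (λ S → not (lookup S v) ∧ Q (S [ v ]≔ true))     ≡⟨ count-cong (λ S → cong (not (lookup S v) ∧_) (Q-insert S)) ⟩
  count (λ S → not (lookup S v) ∧ Q S)
    ≡⟨ count-cong (λ S → remove-both S) ⟩
  count (λ S → (S ⊆ᵇ (A [ v ]≔ false) [ p ]≔ false) ∧ independent E S) ∎
  where
  open ≡-Reasoning
  Q : Family n
  Q S = (S ⊆ᵇ A) ∧ not (lookup S p) ∧ independent E S
  force-neighbour-out : ∀ y w x i → y ∧ w ∧ not (y ∧ x) ∧ i ≡ y ∧ w ∧ not x ∧ i
  force-neighbour-out true  w x i = refl
  force-neighbour-out false w x i = refl
  Q-insert : ∀ S → Q (S [ v ]≔ true) ≡ Q S
  Q-insert S = cong₂ _∧_ (⊆ᵇ-insert S A v v∈A)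
                         (cong₂ (λ x i → not x ∧ i) (lookup∘update′ p≢v S true) (independent-insert-fresh fresh S true))
  remove-both : ∀ S → not (lookup S v) ∧ Q S ≡ (S ⊆ᵇ (A [ v ]≔ false) [ p ]≔ false) ∧ independent E S
  remove-both S = begin
    not (lookup S v) ∧ (S ⊆ᵇ A) ∧ not (lookup S p) ∧ independent E S
      ≡⟨ solve 4 (λ y w x i → y :* (w :* (x :* i)) := (x :* (y :* w)) :* i) refl
           (not (lookup S v)) (S ⊆ᵇ A) (not (lookup S p)) (independent E S) ⟩
    (not (lookup S p) ∧ not (lookup S v) ∧ (S ⊆ᵇ A)) ∧ independent E S
      ≡⟨ cong (_∧ independent E S) (trans (⊆ᵇ-remove S (A [ v ]≔ false) p) (cong (not (lookup S p) ∧_) (⊆ᵇ-remove S A v))) ⟨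
    (S ⊆ᵇ (A [ v ]≔ false) [ p ]≔ false) ∧ independent E S ∎
    where open ∨-∧-Solver

-- A is the set of allowed vertices; forbidding vertices is what makes the leaf recursion close up.
forest⇒fib≤count-independent : {E : List (Edge n)} → Forest E → (A : Subset n) →
               fib (2 + ∣ A ∣) ≤ count (λ S → (S ⊆ᵇ A) ∧ independent E S)
forest⇒fib≤count-independent [] A = begin
  fib (2 + ∣ A ∣)                       ≤⟨ fib[2+n]≤2^n ∣ A ∣ ⟩
  2 ^ ∣ A ∣                             ≡⟨ count-⊆ᵇ A ⟨
  count (_⊆ᵇ A)                         ≡⟨ count-cong (λ S → sym (∧-identityʳ (S ⊆ᵇ A))) ⟩
  count (λ S → (S ⊆ᵇ A) ∧ independent [] S) ∎
  where open ≤-Reasoning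
forest⇒fib≤count-independent (grow {E} {p} {v} p≢v fresh forest) A with lookup A v in v↦b
... | false = ≤-trans (forest⇒fib≤count-independent forest A) (count-mono λ S S∈ →
  let (S⊆A , S-indep) = Equivalence.to T-∧ S∈
      v∉S = ⊆ᵇ-∉ S A v S⊆A v↦b
  in Equivalence.from T-∧ (S⊆A , subst (λ b → T (b ∧ independent E S)) (sym (avoids-absent-leaf p v S v∉S)) S-indep))
... | true = begin
  fib (2 + ∣ A ∣)                       ≡⟨ cong (fib ∘ (2 +_)) (∣A∣≡1+∣remove∣ A v v↦b) ⟩
  fib (2 + ∣ A₁ ∣) + fib (1 + ∣ A₁ ∣)
      ≤⟨ +-mono-≤ (forest⇒fib≤count-independent forest A₁) (≤-trans (fib-mono (s≤s (∣A∣≤1+∣remove∣ A₁ p))) (forest⇒fib≤count-independent forest A₂)) ⟩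
  count (λ S → (S ⊆ᵇ A₁) ∧ independent E S) + count (λ S → (S ⊆ᵇ A₂) ∧ independent E S)
      ≡⟨ cong₂ _+_ (count-omitting-leaf E p v A) (count-containing-leaf p≢v fresh A v↦b) ⟨
  count (λ S → not (lookup S v) ∧ R S) + count (λ S → lookup S v ∧ R S)
      ≡⟨ +-comm (count (λ S → not (lookup S v) ∧ R S)) (count (λ S → lookup S v ∧ R S)) ⟩
  count (λ S → lookup S v ∧ R S) + count (λ S → not (lookup S v) ∧ R S)
      ≡⟨ count-split (λ S → lookup S v) R ⟨
  count R ∎
  where
  open ≤-Reasoning
  A₁ A₂ : Subset _
  A₁ = A [ v ]≔ false
  A₂ = A₁ [ p ]≔ false
  R : Family _
  R S = (S ⊆ᵇ A) ∧ independent (canonical p v ∷ E) S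

edgeList : Graph n → List (Edge n)
edgeList {n} H = filterᵇ (λ p → adj H (proj₁ p) (proj₂ p)) (pairs n)

pairs-ordered : {e : Edge n} → e ∈ₗ pairs n → toℕ (proj₁ e) < toℕ (proj₂ e)
pairs-ordered {n} e∈pairs with satisfied (∈-concatMap⁻ _ {xs = allFin n} e∈pairs)
... | u , e∈row with ∈-map⁻ (λ v → (u , v)) e∈row
...   | v , v∈row , refl = <ᵇ⇒< (toℕ u) (toℕ v) (proj₂ (∈-filterᵇ⁻ (λ w → toℕ u <ᵇ toℕ w) (allFin n) v∈row))

ordered∈pairs : {u v : Fin n} → toℕ u < toℕ v → (u , v) ∈ₗ pairs n
ordered∈pairs {n} {u} {v} u<v =
  ∈-concatMap⁺ _ {xs = allFin n} (lose (∈-allFin u) (∈-map⁺ (u ,_) (∈-filterᵇ⁺ (λ w → toℕ u <ᵇ toℕ w) (∈-allFin v) (<⇒<ᵇ u<v))))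

edgeList-loopless : (H : Graph n) → Loopless (edgeList H)
edgeList-loopless {n} H =
  All.tabulate λ e∈H → <⇒≢ (pairs-ordered (proj₁ (∈-filterᵇ⁻ (λ e → adj H (proj₁ e) (proj₂ e)) (pairs n) e∈H))) ∘ cong toℕ

canonical∈edgeList : (H : Graph n) {p v : Fin n} → p ≢ v → adj H p v ≡ true → canonical p v ∈ₗ edgeList H
canonical∈edgeList H {p} {v} p≢v p~v with toℕ p <ᵇ toℕ v in p<ᵇv
... | true  = ∈-filterᵇ⁺ _ (ordered∈pairs (<ᵇ⇒< (toℕ p) (toℕ v) (subst T (sym p<ᵇv) _))) (subst T (sym p~v) _)
... | false = ∈-filterᵇ⁺ _ (ordered∈pairs v<p) (subst T (sym (trans (Graph.sym H v p) p~v)) _)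
  where
  v<p : toℕ v < toℕ p
  v<p = ≤∧≢⇒< (≮⇒≥ (λ p<v → subst T p<ᵇv (<⇒<ᵇ p<v))) (p≢v ∘ toℕ-injective ∘ sym)

not-any-edge≡independent : (H : Graph n) (S : Subset n) (l : List (Edge n)) →
  not (any (λ e → lookup S (proj₁ e) ∧ lookup S (proj₂ e) ∧ adj H (proj₁ e) (proj₂ e)) l)
    ≡ independent (filterᵇ (λ e → adj H (proj₁ e) (proj₂ e)) l) S
not-any-edge≡independent H S []            = refl
not-any-edge≡independent H S ((u , v) ∷ l) with adj H u v
... | true  = trans (edge (lookup S u) (lookup S v) _) (cong (avoids (u , v) S ∧_) (not-any-edge≡independent H S l))
  where
  edge : ∀ a b r → not (a ∧ b ∧ true ∨ r) ≡ not (a ∧ b) ∧ not r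
  edge false b     r = refl
  edge true  true  r = refl
  edge true  false r = refl
... | false = trans (non-edge (lookup S u) (lookup S v) _) (not-any-edge≡independent H S l)
  where
  non-edge : ∀ a b r → not (a ∧ b ∧ false ∨ r) ≡ not r
  non-edge false b     r = refl
  non-edge true  true  r = refl
  non-edge true  false r = refl

indepCount≡count-independent : (H : Graph n) → indepCount H ≡ count (independent (edgeList H))
indepCount≡count-independent {n} H =
  trans (count-allSubsets (isIndependent H)) (count-cong λ S → not-any-edge≡independent H S (pairs n))

2^n*3^e≤4^e*indepCount : (H : Graph n) → 2 ^ n * 3 ^ edges H ≤ 4 ^ edges H * indepCount H
2^n*3^e≤4^e*indepCount {n} H = begin
  2 ^ n * 3 ^ edges H                      ≡⟨ *-comm (2 ^ n) (3 ^ edges H) ⟩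
  3 ^ edges H * 2 ^ n                      ≡⟨ cong (3 ^ edges H *_) (count-true {n}) ⟨
  3 ^ edges H * count {n} (λ _ → true)     ≤⟨ 3^∣R∣*count≤4^∣R∣*count-independent (λ _ _ → _) (edgeList H) (edgeList-loopless H) ⟩
  4 ^ edges H * count (independent (edgeList H)) ≡⟨ cong (4 ^ edges H *_) (indepCount≡count-independent H) ⟨
  4 ^ edges H * indepCount H               ∎
  where open ≤-Reasoning

-- Spanning trees

crossing-edge : (H : Graph n) (L : Subset n) {u w : Fin n} → Reach H u w → u ∈ L → w ∉ L →
                ∃[ p ] ∃[ v ] p ∈ L × v ∉ L × adj H p v ≡ true
crossing-edge H L here                     u∈L u∉L = ⊥-elim (u∉L u∈L)
crossing-edge H L (step {u} {v} u~v v⇝w) u∈L w∉L with v ∈? L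
... | yes v∈L = crossing-edge H L v⇝w v∈L w∉L
... | no  v∉L = u , v , u∈L , v∉L , u~v

record Subtree {n : ℕ} (H : Graph n) (r : Fin n) (k : ℕ) : Set where
  field
    vertices  : Subset n
    treeEdges : List (Edge n)
    forest    : Forest treeEdges
    edges⊆H   : ∀ {e} → e ∈ₗ treeEdges → e ∈ₗ edgeList H
    spanned   : All (λ e → proj₁ e ∈ vertices × proj₂ e ∈ vertices) treeEdges
    root∈     : r ∈ vertices
    size      : ∣ vertices ∣ ≡ suc k
    #edges    : length treeEdges ≡ k

root-subtree : (H : Graph n) (r : Fin n) → Subtree H r 0
root-subtree H r = record
  { vertices = ⁅ r ⁆ ; treeEdges = [] ; forest = [] ; edges⊆H = λ () ; spanned = []
  ; root∈ = x∈⁅x⁆ r ; size = ∣⁅x⁆∣≡1 r ; #edges = refl }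

leaving-edge : {H : Graph n} {r : Fin n} {k : ℕ} → Connected H → (t : Subtree H r k) → suc k < n →
               ∃[ p ] ∃[ v ] p ∈ Subtree.vertices t × v ∉ Subtree.vertices t × adj H p v ≡ true
leaving-edge {n} {H} {r} connected t 1+k<n =
  let (w , w∉) = ∣p∣<n⇒∃∉ vertices (subst (_< n) (sym size) 1+k<n) in crossing-edge H vertices (connected r w) root∈ w∉
  where open Subtree t

attach-leaf : {H : Graph n} {r : Fin n} {k : ℕ} (t : Subtree H r k) {p v : Fin n} →
              p ∈ Subtree.vertices t → v ∉ Subtree.vertices t → adj H p v ≡ true → Subtree H r (suc k)
attach-leaf {H = H} t {p} {v} p∈ v∉ p~v = record
  { vertices  = vertices [ v ]≔ true
  ; treeEdges = canonical p v ∷ treeEdges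
  ; forest    = grow p≢v (All.map (λ (a∈ , b∈) → ∈⇒≢v a∈ , ∈⇒≢v b∈) spanned) forest
  ; edges⊆H   = λ { (here refl) → canonical∈edgeList H p≢v p~v ; (there e∈) → edges⊆H e∈ }
  ; spanned   = canonical-endpoints (_∈ vertices [ v ]≔ true) (⊆-insert vertices v p∈) ([]≔-updates vertices v)
                ∷ All.map (λ (a∈ , b∈) → ⊆-insert vertices v a∈ , ⊆-insert vertices v b∈) spanned
  ; root∈     = ⊆-insert vertices v root∈
  ; size      = trans (∣insert∣≡1+∣remove∣ vertices v)
                      (cong suc (trans (cong ∣_∣ ([]≔-lookup′ vertices v (∉⇒lookup≡false vertices v v∉))) size))
  ; #edges    = cong suc #edges
  }
  where
  open Subtree t
  ∈⇒≢v : ∀ {a} → a ∈ vertices → a ≢ v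
  ∈⇒≢v a∈ refl = v∉ a∈
  p≢v : p ≢ v
  p≢v = ∈⇒≢v p∈

spanning-subtree : {H : Graph (suc n)} → Connected H → Subtree H zero n
spanning-subtree {n} {H} connected = subtree n ≤-refl
  where
  subtree : ∀ k → k ≤ n → Subtree H zero k
  subtree zero    _     = root-subtree H zero
  subtree (suc k) 1+k≤n =
    let t = subtree k (≤-trans (n≤1+n k) 1+k≤n)
        (_ , _ , p∈ , v∉ , p~v) = leaving-edge connected t (s≤s 1+k≤n)
    in attach-leaf t p∈ v∉ p~v

spanning-subtree⇒3^k*fib≤4^k*indepCount : {m : ℕ} {H : Graph (suc m)} {r : Fin (suc m)} → Subtree H r m →
  ∃[ k ] edges H ≡ m + k × 3 ^ k * fib (3 + m) ≤ 4 ^ k * indepCount H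
spanning-subtree⇒3^k*fib≤4^k*indepCount {m} {H} t with ↭-++-complement (forest-unique (Subtree.forest t)) (Subtree.edges⊆H t)
... | R , H↭T++R = length R , #H≡m+k , (begin
  3 ^ k * fib (2 + suc m)                      ≡⟨ cong (λ a → 3 ^ k * fib (2 + a)) (∣⊤∣≡n (suc m)) ⟨
  3 ^ k * fib (2 + ∣ ⊤ {suc m} ∣)              ≤⟨ *-monoʳ-≤ (3 ^ k) (forest⇒fib≤count-independent forest ⊤) ⟩
  3 ^ k * count (λ S → (S ⊆ᵇ ⊤) ∧ independent tree S)
      ≡⟨ cong (3 ^ k *_) (count-cong (λ S → cong (_∧ independent tree S) (⊆ᵇ-⊤ S))) ⟩
  3 ^ k * count (independent tree)
      ≤⟨ 3^∣R∣*count≤4^∣R∣*count-independent (independent-downClosed tree) R R-loopless ⟩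
  4 ^ k * count (independent tree ∩ independent R)
      ≡⟨ cong (4 ^ k *_) (count-cong (λ S → trans (all-↭ (λ e → avoids e S) H↭T++R) (all-++ (λ e → avoids e S) tree R))) ⟨
  4 ^ k * count (independent (edgeList H))     ≡⟨ cong (4 ^ k *_) (indepCount≡count-independent H) ⟨
  4 ^ k * indepCount H                         ∎)
  where
  open Subtree t renaming (treeEdges to tree)
  open ≤-Reasoning
  k : ℕ
  k = length R
  #H≡m+k : edges H ≡ m + k
  #H≡m+k = trans (↭-length H↭T++R) (trans (length-++ tree) (cong (_+ k) #edges))
  R-loopless : Loopless R
  R-loopless = ++⁻ʳ tree (All-resp-↭ H↭T++R (edgeList-loopless H))

-- Arithmetic with (1 + √5)ⁿ

2^n*2^n≡4^n : ∀ n → 2 ^ n * 2 ^ n ≡ 4 ^ n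
2^n*2^n≡4^n zero    = refl
2^n*2^n≡4^n (suc n) = trans (square-double (2 ^ n)) (cong (4 *_) (2^n*2^n≡4^n n))
  where
  square-double : ∀ t → 2 * t * (2 * t) ≡ 4 * (t * t)
  square-double = solve-∀

sqA+sqB≡2^n*fib[1+n]×2*sqB≡2^n*fib[n] : ∀ n → sqA n + sqB n ≡ 2 ^ n * fib (1 + n) × 2 * sqB n ≡ 2 ^ n * fib n
sqA+sqB≡2^n*fib[1+n]×2*sqB≡2^n*fib[n] zero    = refl , refl
sqA+sqB≡2^n*fib[1+n]×2*sqB≡2^n*fib[n] (suc n) =
  let (a+b≡ , 2b≡) = sqA+sqB≡2^n*fib[1+n]×2*sqB≡2^n*fib[n] n
      a = sqA n ; b = sqB n ; t = 2 ^ n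
  in (begin
        a + 5 * b + (a + b)                 ≡⟨ split a b ⟩
        2 * (a + b) + 2 * (2 * b)           ≡⟨ cong₂ (λ x y → 2 * x + 2 * y) a+b≡ 2b≡ ⟩
        2 * (t * fib (1 + n)) + 2 * (t * fib n) ≡⟨ factor t (fib (1 + n)) (fib n) ⟩
        2 * t * (fib (1 + n) + fib n)       ∎)
   , trans (cong (2 *_) a+b≡) (sym (*-assoc 2 t (fib (1 + n))))
  where
  open ≡-Reasoning
  split : ∀ a b → a + 5 * b + (a + b) ≡ 2 * (a + b) + 2 * (2 * b)
  split = solve-∀
  factor : ∀ t x y → 2 * (t * x) + 2 * (t * y) ≡ 2 * t * (x + y)
  factor = solve-∀

sqA+3*sqB≡2^n*fib[2+n] : ∀ n → sqA n + 3 * sqB n ≡ 2 ^ n * fib (2 + n)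
sqA+3*sqB≡2^n*fib[2+n] n =
  let (a+b≡ , 2b≡) = sqA+sqB≡2^n*fib[1+n]×2*sqB≡2^n*fib[n] n in begin
  sqA n + 3 * sqB n                      ≡⟨ split (sqA n) (sqB n) ⟩
  (sqA n + sqB n) + 2 * sqB n            ≡⟨ cong₂ _+_ a+b≡ 2b≡ ⟩
  2 ^ n * fib (1 + n) + 2 ^ n * fib n    ≡⟨ *-distribˡ-+ (2 ^ n) (fib (1 + n)) (fib n) ⟨
  2 ^ n * fib (2 + n)                    ∎
  where
  open ≡-Reasoning
  split : ∀ a b → a + 3 * b ≡ (a + b) + 2 * b
  split = solve-∀

1≤sqA : ∀ n → 1 ≤ sqA n
1≤sqA zero    = ≤-refl
1≤sqA (suc n) = ≤-trans (1≤sqA n) (m≤m+n (sqA n) (5 * sqB n))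

-- y + z√5 < y + 3z ≤ x.
ltSqrt5 : ∀ {y z x} → 0 < z → y + 3 * z ≤ x → LtSqrt5 y z x
ltSqrt5 {y} {z} {x} 0<z y+3z≤x = <-≤-trans (m<m+n y 0<3z) y+3z≤x , (begin-strict
  5 * (z * z)                 <⟨ m<m+n (5 * (z * z)) (*-mono-< {0} {4} (s≤s z≤n) (*-mono-< 0<z 0<z)) ⟩
  5 * (z * z) + 4 * (z * z)   ≡⟨ nine z ⟩
  3 * z * (3 * z)             ≤⟨ *-mono-≤ 3z≤x∸y 3z≤x∸y ⟩
  (x ∸ y) * (x ∸ y)           ∎)
  where
  open ≤-Reasoning
  0<3z : 0 < 3 * z
  0<3z = ≤-trans 0<z (m≤m+n z (2 * z))
  3z≤x∸y : 3 * z ≤ x ∸ y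
  3z≤x∸y = subst (_≤ x ∸ y) (m+n∸m≡n y (3 * z)) (∸-monoˡ-≤ y y+3z≤x)
  nine : ∀ z → 5 * (z * z) + 4 * (z * z) ≡ 3 * z * (3 * z)
  nine = solve-∀

fib-bound⇒ltSqrt5 : ∀ m k i → 3 ^ k * fib (3 + m) ≤ 4 ^ k * i →
  LtSqrt5 (3 * 2 ^ suc m * 3 ^ (m + k) * sqA (suc m)) (3 * 2 ^ suc m * 3 ^ (m + k) * sqB (suc m))
          (4 * 3 ^ suc m * 4 ^ (m + k) * i)
fib-bound⇒ltSqrt5 m k i bound = ltSqrt5 (*-mono-< {0} {X} {0} 0<X 0<sqB) (begin
  X * sqA n′ + 3 * (X * sqB n′)  ≡⟨ factor X (sqA n′) (sqB n′) ⟩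
  X * (sqA n′ + 3 * sqB n′)      ≡⟨ cong (X *_) (sqA+3*sqB≡2^n*fib[2+n] n′) ⟩
  X * (2 ^ n′ * fib (2 + n′))    ≡⟨ cong (λ c → 3 * 2 ^ n′ * c * (2 ^ n′ * fib (2 + n′))) (^-distribˡ-+-* 3 m k) ⟩
  3 * 2 ^ n′ * (3 ^ m * 3 ^ k) * (2 ^ n′ * fib (2 + n′))
                                 ≡⟨ regroup-3s (2 ^ n′) (3 ^ m) (3 ^ k) (fib (2 + n′)) ⟩
  3 * 3 ^ m * (2 ^ n′ * 2 ^ n′) * (3 ^ k * fib (3 + m))
                                 ≡⟨ cong (λ q → 3 * 3 ^ m * q * (3 ^ k * fib (3 + m))) (2^n*2^n≡4^n n′) ⟩
  3 * 3 ^ m * 4 ^ n′ * (3 ^ k * fib (3 + m))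
                                 ≤⟨ *-monoʳ-≤ (3 * 3 ^ m * 4 ^ n′) bound ⟩
  3 * 3 ^ m * (4 * 4 ^ m) * (4 ^ k * i)
                                 ≡⟨ regroup-4s (3 ^ m) (4 ^ m) (4 ^ k) i ⟩
  4 * 3 ^ n′ * (4 ^ m * 4 ^ k) * i ≡⟨ cong (λ q → 4 * 3 ^ n′ * q * i) (^-distribˡ-+-* 4 m k) ⟨
  4 * 3 ^ n′ * 4 ^ (m + k) * i   ∎)
  where
  open ≤-Reasoning
  n′ X : ℕ
  n′ = suc m
  X  = 3 * 2 ^ n′ * 3 ^ (m + k)
  0<X : 0 < X
  0<X = *-mono-< {0} {3 * 2 ^ n′} {0} (*-mono-< {0} {3} {0} (s≤s z≤n) (m^n>0 2 n′)) (m^n>0 3 (m + k))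
  0<sqB : 0 < sqB n′
  0<sqB = ≤-trans (1≤sqA m) (m≤m+n (sqA m) (sqB m))
  factor : ∀ x a b → x * a + 3 * (x * b) ≡ x * (a + 3 * b)
  factor = solve-∀
  regroup-3s : ∀ t a c f → 3 * t * (a * c) * (t * f) ≡ 3 * a * (t * t) * (c * f)
  regroup-3s = solve-∀
  regroup-4s : ∀ a q d i → 3 * a * (4 * q) * (d * i) ≡ 4 * (3 * a) * (q * d) * i
  regroup-4s = solve-∀

corollary1p4 : ∀ (n : ℕ) (H : Graph n) →
    (2 ^ n * 3 ^ edges H ≤ 4 ^ edges H * indepCount H)
    × (Connected H →
       LtSqrt5 (3 * 2 ^ n * 3 ^ edges H * sqA n) (3 * 2 ^ n * 3 ^ edges H * sqB n)
               (4 * 3 ^ n * 4 ^ edges H * indepCount H))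
corollary1p4 n H = 2^n*3^e≤4^e*indepCount H , connected-case n H
  where
  connected-case : ∀ n (H : Graph n) → Connected H →
    LtSqrt5 (3 * 2 ^ n * 3 ^ edges H * sqA n) (3 * 2 ^ n * 3 ^ edges H * sqB n) (4 * 3 ^ n * 4 ^ edges H * indepCount H)
  connected-case zero    H _ = ≤-refl , ≤-refl  -- the empty graph: LtSqrt5 3 0 4
  connected-case (suc m) H connected with spanning-subtree⇒3^k*fib≤4^k*indepCount (spanning-subtree connected)
  ... | k , #H≡m+k , bound rewrite #H≡m+k = fib-bound⇒ltSqrt5 m k (indepCount H) bound
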